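{- Let $\mathcal{N}$ be a near hexagon of order $(2,t)$ and let $\mathcal{H}$ be a full subgeometry of $\mathcal{N}$ isomorphic to $H(2)$ and isometrically embedded in $\mathcal{N}$. If $L=\{x_1,x_2,x_3\}$ is a line of $\mathcal{N}$, then $f_{x_1},f_{x_2},f_{x_3}$ are mutually distinct, and hence $\{f_{x_1},f_{x_2},f_{x_3}\}$ is a line of the valuation geometry $\mathcal{V}$ of $\mathcal{H}$.
   Context: A near hexagon is a partial linear space whose collinearity graph is connected of diameter $3$ such that for every point $x$ and line $L$ there is a unique point on $L$ nearest to $x$; order $(2,t)$: three points per line, $t+1$ lines per point ($t$ possibly infinite). Full and isometrically embedded: lines of $\mathcal{H}$ contain all their $\mathcal{N}$-points and distances agree. $H(2)$ is the split Cayley hexagon of order $2$. A valuation of $\mathcal{H}$ is a map $f$ from the points of $\mathcal{H}$ to $\mathbb{Z}$ with minimum $0$ such that each line has a unique point of minimal $f$-value and its other points have value one larger. For a point $x$ of $\mathcal{N}$, $f_x(y)=\mathrm{d}(x,y)-\mathrm{d}(x,\mathcal{H})$. Valuations $f_1,f_2$ are neighboring if there is $\epsilon\in\mathbb{Z}$ with $|f_1(y)-f_2(y)+\epsilon|\le1$ for all $y$; then $f_1\ast f_2=f_3'-\min f_3'$ where $f_3'(y)=f_1(y)-1$ if $f_1(y)=f_2(y)-\epsilon$ and $f_3'(y)=\max\{f_1(y),f_2(y)-\epsilon\}$ otherwise. The valuation geometry $\mathcal{V}$ has the valuations of $\mathcal{H}$ as points and the triples $\{f_1,f_2,f_3\}$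 of mutually distinct valuations with $f_1,f_2$ neighboring and $f_3=f_1\ast f_2$ as lines. -}

module Defs where

open import Data.Bool using (Bool; true; false; _∧_; _∨_; not; _xor_; T; if_then_else_)
open import Data.Nat as ℕ using (ℕ; zero; suc; _≤_; _<_; _<ᵇ_; _⊓_)
open import Data.Integer as ℤ using (ℤ; +_; _-_; ∣_∣)
open import Data.Fin using (Fin; #_)
open import Data.Vec using (Vec; []; _∷_; lookup; zipWith; foldr)
open import Data.List as List using (List; []; _∷_; map; mapMaybe; concatMap)
open import Data.Maybe using (Maybe; just; nothing)
open import Data.Product using (Σ; Σ-syntax; ∃; ∃-syntax; _×_; _,_; proj₁)
open import Data.Sum using (_⊎_)
open import Data.Unit using (tt)
open import Relation.Nullary using (¬_)
open import Relation.Binary.PropositionalEquality using (_≡_; _≢_; subst; sym)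
open import Function.Bundles using (_⇔_)

module _ {P L : Set} (_I_ : P → L → Set) where

  Collinear : P → P → Set
  Collinear x y = x ≢ y × ∃[ l ] (x I l × y I l)

  data Walk : P → P → ℕ → Set where
    here : ∀ {x} → Walk x x zero
    step : ∀ {x y z n} → Collinear x y → Walk y z n → Walk x z (suc n)

  Dist : P → P → ℕ → Set
  Dist x y n = Walk x y n × (∀ m → m < n → ¬ Walk x y m)

record NearHexagon : Set₁ where
  field
    Point : Set
    Line  : Set
    _I_   : Point → Line → Set
    three-points : ∀ l → Σ[ a ∈ Point ] Σ[ b ∈ Point ] Σ[ c ∈ Point ]
                     (a I l × b I l × c I l × a ≢ b × a ≢ c × b ≢ c ×
                      (∀ p → p I l → p ≡ a ⊎ p ≡ b ⊎ p ≡ c))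
    some-line : ∀ x → ∃[ l ] (x I l)
    partial-linear : ∀ {x y l m} → x ≢ y → x I l → y I l → x I m → y I m → l ≡ m
    distance : ∀ x y → Σ[ n ∈ ℕ ] (n ≤ 3 × Dist _I_ x y n)
    diameter-3 : ∃[ x ] ∃[ y ] Dist _I_ x y 3

  d : Point → Point → ℕ
  d x y = proj₁ (distance x y)

  field
    nearest : ∀ x l → ∃[ p ] (p I l × (∀ q → q I l → q ≢ p → d x p < d x q))

-- The split Cayley hexagon H(2), in Tits' model on the parabolic quadric
-- Q(6,2) : X0X4 + X1X5 + X2X6 = X3² of PG(6,2).

Vec7 : Set
Vec7 = Vec Bool 7

_⊕_ : Vec7 → Vec7 → Vec7
_⊕_ = zipWith _xor_

num : Vec7 → ℕ
num = foldr (λ _ → ℕ) (λ b n → (if b then 1 else 0) ℕ.+ 2 ℕ.* n) 0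

nonzero : Vec7 → Bool
nonzero = foldr (λ _ → Bool) _∨_ false

quad : Vec7 → Bool
quad x = ((lookup x (# 0) ∧ lookup x (# 4)) xor (lookup x (# 1) ∧ lookup x (# 5)))
         xor ((lookup x (# 2) ∧ lookup x (# 6)) xor lookup x (# 3))

isPoint : Vec7 → Bool
isPoint x = nonzero x ∧ not (quad x)

-- Grassmann coordinate p_ij of the line spanned by x and y (mod 2)
pl : Vec7 → Vec7 → Fin 7 → Fin 7 → Bool
pl x y i j = (lookup x i ∧ lookup y j) xor (lookup x j ∧ lookup y i)

_==_ : Bool → Bool → Bool
a == b = not (a xor b)

-- line condition for the line {x, y, x+y} of Q(6,2) to be a line of H(2)
hexCond : Vec7 → Vec7 → Bool
hexCond x y =
  (pl x y (# 1) (# 2) == pl x y (# 3) (# 4)) ∧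
  (pl x y (# 5) (# 4) == pl x y (# 3) (# 2)) ∧
  (pl x y (# 2) (# 0) == pl x y (# 3) (# 5)) ∧
  (pl x y (# 6) (# 5) == pl x y (# 3) (# 0)) ∧
  (pl x y (# 0) (# 1) == pl x y (# 3) (# 6)) ∧
  (pl x y (# 1) (# 3) == pl x y (# 4) (# 6))

-- a line is represented canonically by its two points of smallest index
isLine : Vec7 → Vec7 → Bool
isLine x y = isPoint x ∧ isPoint y ∧ isPoint (x ⊕ y) ∧
             (num x <ᵇ num y) ∧ (num y <ᵇ num (x ⊕ y)) ∧ hexCond x y

H2Point : Set
H2Point = Σ[ x ∈ Vec7 ] T (isPoint x)

H2Line : Set
H2Line = Σ[ xy ∈ Vec7 × Vec7 ] T (isLine (Data.Product.proj₁ xy) (Data.Product.proj₂ xy))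

_I₂_ : H2Point → H2Line → Set
(p , _) I₂ ((x , y) , _) = p ≡ x ⊎ p ≡ y ⊎ p ≡ x ⊕ y

allVec7 : List Vec7
allVec7 = go 7
  where
  go : (n : ℕ) → List (Vec Bool n)
  go zero = [] ∷ []
  go (suc n) = concatMap (λ v → (false ∷ v) ∷ (true ∷ v) ∷ []) (go n)

mkPoint : Vec7 → Maybe H2Point
mkPoint x with isPoint x in eq
... | true  = just (x , subst T (sym eq) tt)
... | false = nothing

allH2Points : List H2Point
allH2Points = mapMaybe mkPoint allVec7

basePoint : H2Point
basePoint = (true ∷ false ∷ false ∷ false ∷ false ∷ false ∷ false ∷ []) , tt

minOverH2ℕ : (H2Point → ℕ) → ℕ
minOverH2ℕ f = List.foldr _⊓_ (f basePoint) (map f allH2Points)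

minOverH2ℤ : (H2Point → ℤ) → ℤ
minOverH2ℤ f = List.foldr ℤ._⊓_ (f basePoint) (map f allH2Points)

-- A full, isometrically embedded subgeometry of N isomorphic to H(2),
-- given by an isomorphism (h , hl) from H(2) onto the subgeometry.

record IsometricH2 (N : NearHexagon) : Set where
  open NearHexagon N
  field
    h  : H2Point → Point
    hl : H2Line → Line
    h-injective  : ∀ p q → h p ≡ h q → p ≡ q
    hl-injective : ∀ l m → hl l ≡ hl m → l ≡ m
    incidence : ∀ p l → (p I₂ l) ⇔ (h p I hl l)
    full : ∀ x l → x I hl l → ∃[ p ] (h p ≡ x)
    isometric : ∀ p q n → Dist _I₂_ p q n ⇔ Dist _I_ (h p) (h q) n

Valuation : Set
Valuation = H2Point → ℤ

IsValuation : Valuation → Set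
IsValuation f =
  (∀ y → + 0 ℤ.≤ f y) × (∃[ y ] f y ≡ + 0) ×
  (∀ l → ∃[ p ] (p I₂ l × ∀ q → q I₂ l → q ≢ p → f q ≡ f p ℤ.+ + 1))

_≗_ : Valuation → Valuation → Set
f ≗ g = ∀ y → f y ≡ g y

Neighboring : Valuation → Valuation → ℤ → Set
Neighboring f₁ f₂ ε = ∀ y → ∣ f₁ y - f₂ y ℤ.+ ε ∣ ≤ 1

star' : Valuation → Valuation → ℤ → Valuation
star' f₁ f₂ ε y with f₁ y ℤ.≟ f₂ y - ε
... | Relation.Nullary.yes _ = f₁ y - + 1
... | Relation.Nullary.no  _ = f₁ y ℤ.⊔ (f₂ y - ε)

star : Valuation → Valuation → ℤ → Valuation
star f₁ f₂ ε y = star' f₁ f₂ ε y - minOverH2ℤ (star' f₁ f₂ ε)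

OrderedVLine : Valuation → Valuation → Valuation → Set
OrderedVLine f₁ f₂ f₃ = ∃[ ε ] (Neighboring f₁ f₂ ε × f₃ ≗ star f₁ f₂ ε)

MutuallyDistinct : Valuation → Valuation → Valuation → Set
MutuallyDistinct f g k = ¬ (f ≗ g) × ¬ (f ≗ k) × ¬ (g ≗ k)

IsVLine : Valuation → Valuation → Valuation → Set
IsVLine f g k =
  IsValuation f × IsValuation g × IsValuation k × MutuallyDistinct f g k ×
  (OrderedVLine f g k ⊎ OrderedVLine f k g ⊎ OrderedVLine g f k ⊎
   OrderedVLine g k f ⊎ OrderedVLine k f g ⊎ OrderedVLine k g f)

fval : (N : NearHexagon) → IsometricH2 N → NearHexagon.Point N → Valuation
fval N H x y = + d x (h y) - + minOverH2ℕ (λ z → d x (h z))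
  where open NearHexagon N
        open IsometricH2 H

module Submission where

-- For a point y and a line L = {x₁, x₂, x₃} of a near hexagon, one point of L is nearest to y and the
-- other two are one step further. Applied to the points y of 𝓗, this shows that f_{x₁} and f_{x₂} are
-- neighboring with ε = d(x₁,𝓗) − d(x₂,𝓗), and evaluating the rule that defines f_{x₁} ∗ f_{x₂} in each
-- of the three configurations gives f_{x₃}.
-- If f_{x₁} = f_{x₂}, then d(x₁,y) − d(x₂,y) is constant on 𝓗, so one and the same point of L is nearest
-- to every point of 𝓗 and is at distance at most 2 from all of 𝓗. No point of 𝓝 is: the distances from
-- a point x to two opposite points of H(2) add up to at least 3, and in Tits' model a few lines and
-- opposite pairs then force x to be a point of 𝓗, which has an opposite point at distance 3 from x.

open import Defs
open import Data.Bool as Bool using (Bool; true; false; _∧_; _xor_; T)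
open import Data.Bool.ListAction using (any)
open import Data.Bool.Properties
  using (T-irrelevant; ∧-comm; xor-comm; xor-assoc; xor-same; xor-annihilates-not)
open import Data.Nat as ℕ using (ℕ; zero; suc; _+_; _≤_; _<_; z≤n; s≤s; s≤s⁻¹)
import Data.Nat.Properties as ℕ
open import Data.Integer as ℤ using (ℤ; +_; _-_; _⊔_; ∣_∣; +≤+; +<+)
import Data.Integer.Properties as ℤ
open import Data.Integer.Tactic.RingSolver using (solve-∀)
open import Data.Fin as Fin using (Fin; zero; suc; toℕ; #_)
open import Data.Fin.Properties using (pigeonhole)
open import Data.Vec using (Vec; []; _∷_; lookup; zipWith; tabulate)
open import Data.Vec.Properties using (lookup-zipWith; zipWith-comm; ≡-dec)
import Data.Vec.Relation.Unary.All as All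
open import Data.Vec.Relation.Unary.All.Properties using (lookup⁺)
open import Data.List as List using (List; []; _∷_; map; foldr)
open import Data.List.Membership.Propositional using (_∈_)
open import Data.List.Relation.Unary.Any as Any using (Any; any?; here; there)
open import Data.Product using (∃; ∃-syntax; ∃₂; _×_; _,_; proj₁; proj₂)
open import Data.Sum using (_⊎_; inj₁; inj₂; [_,_])
open import Data.Empty using (⊥; ⊥-elim)
open import Function using (_∘_)
open import Function.Bundles using (Equivalence)
open import Algebra.Construct.NaturalChoice.Base using (MinOperator)
import Algebra.Construct.NaturalChoice.MinOp as MinOp
open import Relation.Binary.Bundles using (TotalPreorder)
open import Relation.Binary.Definitions using (tri<; tri≈; tri>)
open import Relation.Nullary using (Dec; ¬_; yes; no)
open import Relation.Nullary.Decidable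
  using (map′; _×-dec_; _⊎-dec_; _→-dec_; False; toWitness; toWitnessFalse)
open import Relation.Unary using (Decidable)
open import Relation.Binary.PropositionalEquality
  using (_≡_; _≢_; refl; sym; trans; cong; cong₂; subst; ≢-sym; module ≡-Reasoning)

module _ {P L : Set} {_I_ : P → L → Set} where

  Collinear-sym : ∀ {x y} → Collinear _I_ x y → Collinear _I_ y x
  Collinear-sym (x≢y , l , xI , yI) = ≢-sym x≢y , l , yI , xI

  walk-snoc : ∀ {x y z n} → Walk _I_ x y n → Collinear _I_ y z → Walk _I_ x z (suc n)
  walk-snoc here        c = step c here
  walk-snoc (step c′ w) c = step c′ (walk-snoc w c)

  walk-reverse : ∀ {x y n} → Walk _I_ x y n → Walk _I_ y x n
  walk-reverse here       = here
  walk-reverse (step c w) = walk-snoc (walk-reverse w) (Collinear-sym c)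

  walk-++ : ∀ {x y z m n} → Walk _I_ x y m → Walk _I_ y z n → Walk _I_ x z (m + n)
  walk-++ here       w′ = w′
  walk-++ (step c w) w′ = step c (walk-++ w w′)

-- Distances from a point to the three points of a line

data LineProfile : ℕ → ℕ → ℕ → Set where
  nearest₁ : ∀ m → LineProfile m (suc m) (suc m)
  nearest₂ : ∀ m → LineProfile (suc m) m (suc m)
  nearest₃ : ∀ m → LineProfile (suc m) (suc m) m

profile₁ : ∀ {a b c} → b ≡ suc a → c ≡ suc a → LineProfile a b c
profile₁ refl refl = nearest₁ _

profile₂ : ∀ {a b c} → a ≡ suc b → c ≡ suc b → LineProfile a b c
profile₂ refl refl = nearest₂ _

profile₃ : ∀ {a b c} → a ≡ suc c → b ≡ suc c → LineProfile a b c
profile₃ refl refl = nearest₃ _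

profile-cong : ∀ {a b c a′ b′ c′} → a ≡ a′ → b ≡ b′ → c ≡ c′ →
               LineProfile a b c → LineProfile a′ b′ c′
profile-cong refl refl refl profile = profile

profile-swap₁₂ : ∀ {a b c} → LineProfile a b c → LineProfile b a c
profile-swap₁₂ (nearest₁ m) = nearest₂ m
profile-swap₁₂ (nearest₂ m) = nearest₁ m
profile-swap₁₂ (nearest₃ m) = nearest₃ m

profile-≡ : ∀ {a b c} → LineProfile a b c → a ≡ b → a ≡ suc c
profile-≡ (nearest₁ m) ()
profile-≡ (nearest₂ m) ()
profile-≡ (nearest₃ m) _ = refl

profile-< : ∀ {a b c} → LineProfile a b c → a < b → b ≡ suc a
profile-< (nearest₁ m) _ = refl
profile-< (nearest₂ m) m<m = ⊥-elim (ℕ.<-asym m<m (ℕ.n<1+n m))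
profile-< (nearest₃ m) m<m = ⊥-elim (ℕ.<-irrefl refl m<m)

profile-nearest : ∀ {a b c n} → LineProfile a b c → b ≡ suc n → c ≡ suc n → a ≡ n
profile-nearest (nearest₁ m) refl refl = refl
profile-nearest (nearest₂ m) refl ()
profile-nearest (nearest₃ m) () refl

profile-closer : ∀ {a b c n} → LineProfile a b c → a ≤ suc n → b ≤ suc n → c ≤ suc n →
                 a ≤ n ⊎ b ≤ n ⊎ c ≤ n
profile-closer (nearest₁ m) _ b≤ _ = inj₁ (s≤s⁻¹ b≤)
profile-closer (nearest₂ m) a≤ _ _ = inj₂ (inj₁ (s≤s⁻¹ a≤))
profile-closer (nearest₃ m) a≤ _ _ = inj₂ (inj₂ (s≤s⁻¹ a≤))

profile-neighboring : ∀ {a b c} → LineProfile a b c → ∣ + a - + b ∣ ≤ 1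
profile-neighboring (nearest₁ m) = ℕ.≤-reflexive (cong ∣_∣ (x-[1+x]≡-1 (+ m)))
  where
  x-[1+x]≡-1 : ∀ x → x - (+ 1 ℤ.+ x) ≡ ℤ.- + 1
  x-[1+x]≡-1 = solve-∀
profile-neighboring (nearest₂ m) = ℕ.≤-reflexive (cong ∣_∣ ([1+x]-x≡1 (+ m)))
  where
  [1+x]-x≡1 : ∀ x → (+ 1 ℤ.+ x) - x ≡ + 1
  [1+x]-x≡1 = solve-∀
profile-neighboring (nearest₃ m) = subst (λ i → ∣ i ∣ ≤ 1) (sym (ℤ.+-inverseʳ (+ suc m))) z≤n

merge : ℤ → ℤ → ℤ
merge i j with i ℤ.≟ j
... | yes _ = i - + 1
... | no  _ = i ⊔ j

star′-merge : ∀ f₁ f₂ ε y → star' f₁ f₂ ε y ≡ merge (f₁ y) (f₂ y - ε)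
star′-merge f₁ f₂ ε y with f₁ y ℤ.≟ f₂ y - ε
... | yes _ = refl
... | no  _ = refl

merge-≡ : ∀ i → merge i i ≡ i - + 1
merge-≡ i with i ℤ.≟ i
... | yes _   = refl
... | no  i≢i = ⊥-elim (i≢i refl)

merge-≢ : ∀ {i j} → i ≢ j → merge i j ≡ i ⊔ j
merge-≢ {i} {j} i≢j with i ℤ.≟ j
... | yes i≡j = ⊥-elim (i≢j i≡j)
... | no  _   = refl

m-k<1+m-k : ∀ m k → + m - k ℤ.< + suc m - k
m-k<1+m-k m k = ℤ.+-monoˡ-< (ℤ.- k) (+<+ (ℕ.n<1+n m))

profile-merge : ∀ {a b c} → LineProfile a b c → ∀ k → merge (+ a - k) (+ b - k) ≡ + c - k
profile-merge (nearest₁ m) k =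
  trans (merge-≢ (ℤ.<⇒≢ (m-k<1+m-k m k))) (ℤ.i≤j⇒i⊔j≡j (ℤ.<⇒≤ (m-k<1+m-k m k)))
profile-merge (nearest₂ m) k =
  trans (merge-≢ (≢-sym (ℤ.<⇒≢ (m-k<1+m-k m k)))) (ℤ.i≥j⇒i⊔j≡i (ℤ.<⇒≤ (m-k<1+m-k m k)))
profile-merge (nearest₃ m) k = trans (merge-≡ (+ suc m - k)) ([1+i-k]-1≡i-k (+ m) k)
  where
  [1+i-k]-1≡i-k : ∀ i k → ((+ 1 ℤ.+ i) - k) - + 1 ≡ i - k
  [1+i-k]-1≡i-k = solve-∀

module _ {A : Set} {a b c : A} where

  position : ∀ {t} → t ≡ a ⊎ t ≡ b ⊎ t ≡ c → Fin 3
  position (inj₁ _)        = zero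
  position (inj₂ (inj₁ _)) = suc zero
  position (inj₂ (inj₂ _)) = suc (suc zero)

  position-correct : ∀ {t} (e : t ≡ a ⊎ t ≡ b ⊎ t ≡ c) →
                     t ≡ lookup (a ∷ b ∷ c ∷ []) (position e)
  position-correct (inj₁ e)        = e
  position-correct (inj₂ (inj₁ e)) = e
  position-correct (inj₂ (inj₂ e)) = e

  four-among-three : (p : Fin 4 → A) → (∀ i → p i ≡ a ⊎ p i ≡ b ⊎ p i ≡ c) →
                     ∃₂ λ i j → i Fin.< j × p i ≡ p j
  four-among-three p p∈ with pigeonhole (s≤s (s≤s (s≤s (s≤s z≤n)))) (λ i → position (p∈ i))
  ... | i , j , i<j , same =
    i , j , i<j , trans (position-correct (p∈ i))
                        (trans (cong (lookup (a ∷ b ∷ c ∷ [])) same) (sym (position-correct (p∈ j))))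

module Distance (N : NearHexagon) where
  open NearHexagon N

  d-minimal : ∀ {x y n} → Walk _I_ x y n → d x y ≤ n
  d-minimal {x} {y} {n} w with ℕ.≤-<-connex (d x y) n
  ... | inj₁ d≤n = d≤n
  ... | inj₂ n<d = ⊥-elim (proj₂ (proj₂ (proj₂ (distance x y))) n n<d w)

  d-walk : ∀ x y → Walk _I_ x y (d x y)
  d-walk x y = proj₁ (proj₂ (proj₂ (distance x y)))

  d≤3 : ∀ x y → d x y ≤ 3
  d≤3 x y = proj₁ (proj₂ (distance x y))

  d-sym : ∀ x y → d x y ≡ d y x
  d-sym x y =
    ℕ.≤-antisym (d-minimal (walk-reverse (d-walk y x))) (d-minimal (walk-reverse (d-walk x y)))

  d-triangle : ∀ x y z → d x z ≤ d x y + d y z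
  d-triangle x y z = d-minimal (walk-++ (d-walk x y) (d-walk y z))

  d-collinear : ∀ {x y z} → Collinear _I_ y z → d x z ≤ suc (d x y)
  d-collinear {x} {y} c = d-minimal (walk-snoc (d-walk x y) c)

  nearest-distance : ∀ {x l p q} → p I l → (∀ r → r I l → r ≢ p → d x p < d x r) →
                     q I l → q ≢ p → d x q ≡ suc (d x p)
  nearest-distance pI near qI q≢p =
    ℕ.≤-antisym (d-collinear (≢-sym q≢p , _ , pI , qI)) (near _ qI q≢p)

  fourth-point-on-line : ∀ {l u v w p} → u I l → v I l → w I l → p I l →
                         u ≢ v → u ≢ w → v ≢ w → p ≡ u ⊎ p ≡ v ⊎ p ≡ w
  fourth-point-on-line {l} {u} {v} {w} {p} uI vI wI pI u≢v u≢w v≢w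
    with three-points l
  ... | _ , _ , _ , _ , _ , _ , _ , _ , _ , on-l
    with four-among-three (lookup (u ∷ v ∷ w ∷ p ∷ []))
           (λ i → on-l _ (lookup⁺ {P = _I l} (uI All.∷ vI All.∷ wI All.∷ pI All.∷ All.[]) i))
  ... | zero ,             suc zero ,             _ , u≡v = ⊥-elim (u≢v u≡v)
  ... | zero ,             suc (suc zero) ,       _ , u≡w = ⊥-elim (u≢w u≡w)
  ... | suc zero ,         suc (suc zero) ,       _ , v≡w = ⊥-elim (v≢w v≡w)
  ... | zero ,             suc (suc (suc zero)) , _ , u≡p = inj₁ (sym u≡p)
  ... | suc zero ,         suc (suc (suc zero)) , _ , v≡p = inj₂ (inj₁ (sym v≡p))
  ... | suc (suc zero) ,   suc (suc (suc zero)) , _ , w≡p = inj₂ (inj₂ (sym w≡p))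
  ... | _ ,                zero ,                 () , _
  ... | suc _ ,            suc zero ,             s≤s () , _
  ... | suc (suc _) ,      suc (suc zero) ,       s≤s (s≤s ()) , _
  ... | suc (suc (suc _)) , suc (suc (suc zero)) , s≤s (s≤s (s≤s ())) , _

  line-profile : ∀ {l u v w} → u I l → v I l → w I l → u ≢ v → u ≢ w → v ≢ w →
                 ∀ z → LineProfile (d u z) (d v z) (d w z)
  line-profile {l} {u} {v} {w} uI vI wI u≢v u≢w v≢w z with nearest z l
  ... | p , pI , near = profile (fourth-point-on-line uI vI wI pI u≢v u≢w v≢w)
    where
    further : ∀ {q} → q I l → q ≢ p → d q z ≡ suc (d p z)
    further {q} qI q≢p =
      trans (d-sym q z) (trans (nearest-distance pI near qI q≢p) (cong suc (d-sym z p)))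

    profile : p ≡ u ⊎ p ≡ v ⊎ p ≡ w → LineProfile (d u z) (d v z) (d w z)
    profile (inj₁ refl)        = profile₁ (further vI (≢-sym u≢v)) (further wI (≢-sym u≢w))
    profile (inj₂ (inj₁ refl)) = profile₂ (further uI u≢v) (further wI (≢-sym v≢w))
    profile (inj₂ (inj₂ refl)) = profile₃ (further uI u≢w) (further vI v≢w)

-- Tits' model of H(2)

∀-vector? : ∀ {n} {P : Vec Bool n → Set} → Decidable P → Dec (∀ v → P v)
∀-vector? {zero} P? = map′ (λ p → λ { [] → p }) (λ ∀P → ∀P []) (P? [])
∀-vector? {suc n} P? =
  map′ (λ (P₀ , P₁) → λ { (false ∷ v) → P₀ v ; (true ∷ v) → P₁ v })
       (λ ∀P → ∀P ∘ (false ∷_) , ∀P ∘ (true ∷_))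
       (∀-vector? (P? ∘ (false ∷_)) ×-dec ∀-vector? (P? ∘ (true ∷_)))

∃-vector? : ∀ {n} {P : Vec Bool n → Set} → Decidable P → Dec (∃ P)
∃-vector? {zero} P? = map′ ([] ,_) (λ { ([] , p) → p }) (P? [])
∃-vector? {suc n} P? =
  map′ [ (λ (v , p) → false ∷ v , p) , (λ (v , p) → true ∷ v , p) ]
       (λ { (false ∷ v , p) → inj₁ (v , p) ; (true ∷ v , p) → inj₂ (v , p) })
       (∃-vector? (P? ∘ (false ∷_)) ⊎-dec ∃-vector? (P? ∘ (true ∷_)))

point-≡ : ∀ {p q : H2Point} → proj₁ p ≡ proj₁ q → p ≡ q
point-≡ {v , s} {.v , t} refl = cong (v ,_) (T-irrelevant s t)

-- Checked by evaluating the decision procedure on all 128 vectors.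
every-point-listed : ∀ v → T (isPoint v) → Any (λ q → v ≡ proj₁ q) allH2Points
every-point-listed = toWitness {a? = ∀-vector? λ v →
  Bool.T? (isPoint v) →-dec any? (λ q → ≡-dec Bool._≟_ v (proj₁ q)) allH2Points} _

allH2Points-complete : ∀ p → p ∈ allH2Points
allH2Points-complete (v , s) = Any.map point-≡ (every-point-listed v s)

⊕-comm : ∀ {n} (x y : Vec Bool n) → zipWith _xor_ x y ≡ zipWith _xor_ y x
⊕-comm = zipWith-comm xor-comm

⊕-cancelˡ : ∀ {n} (x y : Vec Bool n) → zipWith _xor_ x (zipWith _xor_ x y) ≡ y
⊕-cancelˡ []      []      = refl
⊕-cancelˡ (a ∷ x) (b ∷ y) =
  cong₂ _∷_ (trans (sym (xor-assoc a a b)) (cong (_xor b) (xor-same a))) (⊕-cancelˡ x y)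

pl-sym : ∀ u v i j → pl v u i j ≡ pl u v i j
pl-sym u v i j =
  trans (xor-comm (lookup v i ∧ lookup u j) _)
        (cong₂ _xor_ (∧-comm (lookup v j) (lookup u i)) (∧-comm (lookup v i) (lookup u j)))

pl-⊕ʳ : ∀ x y i j → pl x (x ⊕ y) i j ≡ pl x y i j
pl-⊕ʳ x y i j rewrite lookup-zipWith _xor_ i x y | lookup-zipWith _xor_ j x y =
  alternating (lookup x i) (lookup y i) (lookup y j) (lookup x j)
  where
  alternating : ∀ a b c d → (a ∧ (d xor c)) xor (d ∧ (a xor b)) ≡ (a ∧ c) xor (d ∧ b)
  alternating false b c d     = refl
  alternating true  b c false = refl
  alternating true  b c true  = xor-annihilates-not c b

-- hexCond with the Grassmann coordinates as a parameter, so that they can be rewritten.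
hexCondOf : (Fin 7 → Fin 7 → Bool) → Bool
hexCondOf P =
  (P (# 1) (# 2) == P (# 3) (# 4)) ∧
  (P (# 5) (# 4) == P (# 3) (# 2)) ∧
  (P (# 2) (# 0) == P (# 3) (# 5)) ∧
  (P (# 6) (# 5) == P (# 3) (# 0)) ∧
  (P (# 0) (# 1) == P (# 3) (# 6)) ∧
  (P (# 1) (# 3) == P (# 4) (# 6))

hexCondOf-cong : ∀ {P Q} → (∀ i j → P i j ≡ Q i j) → hexCondOf P ≡ hexCondOf Q
hexCondOf-cong e
  rewrite e (# 1) (# 2) | e (# 3) (# 4) | e (# 5) (# 4) | e (# 3) (# 2)
        | e (# 2) (# 0) | e (# 3) (# 5) | e (# 6) (# 5) | e (# 3) (# 0)
        | e (# 0) (# 1) | e (# 3) (# 6) | e (# 1) (# 3) | e (# 4) (# 6) = refl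

hexCond-sym : ∀ u v → hexCond v u ≡ hexCond u v
hexCond-sym u v = hexCondOf-cong (pl-sym u v)

hexCond-⊕ʳ : ∀ x y → hexCond x (x ⊕ y) ≡ hexCond x y
hexCond-⊕ʳ x y = hexCondOf-cong (pl-⊕ʳ x y)

record Adjacent (u v : Vec7) : Set where
  constructor adjacent
  field
    isPoint₁   : T (isPoint u)
    isPoint₂   : T (isPoint v)
    hexagonal  : T (hexCond u v)
    isPoint-⊕ : T (isPoint (u ⊕ v))

adjacent? : ∀ u v → Dec (Adjacent u v)
adjacent? u v = map′ (λ (pu , pv , hc , ps) → adjacent pu pv hc ps)
                     (λ (adjacent pu pv hc ps) → pu , pv , hc , ps)
                     (Bool.T? _ ×-dec Bool.T? _ ×-dec Bool.T? _ ×-dec Bool.T? _)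

adjacent-sym : ∀ {u v} → Adjacent u v → Adjacent v u
adjacent-sym {u} {v} (adjacent pu pv hc ps) =
  adjacent pv pu (subst T (sym (hexCond-sym u v)) hc) (subst (T ∘ isPoint) (⊕-comm u v) ps)

adjacent-⊕ : ∀ {u v} → Adjacent u v → Adjacent u (u ⊕ v)
adjacent-⊕ {u} {v} (adjacent pu pv hc ps) =
  adjacent pu ps (subst T (sym (hexCond-⊕ʳ u v)) hc) (subst (T ∘ isPoint) (sym (⊕-cancelˡ u v)) pv)

isLine-parts : ∀ x y → T (isLine x y) →
  T (isPoint x) × T (isPoint y) × T (isPoint (x ⊕ y)) ×
  T (num x ℕ.<ᵇ num y) × T (num y ℕ.<ᵇ num (x ⊕ y)) × T (hexCond x y)
isLine-parts x y t
  with isPoint x | isPoint y | isPoint (x ⊕ y) | num x ℕ.<ᵇ num y | num y ℕ.<ᵇ num (x ⊕ y) | hexCond x y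
... | true | true | true | true | true | true = _
isLine-parts x y () | false | _     | _     | _     | _     | _
isLine-parts x y () | true  | false | _     | _     | _     | _
isLine-parts x y () | true  | true  | false | _     | _     | _
isLine-parts x y () | true  | true  | true  | false | _     | _
isLine-parts x y () | true  | true  | true  | true  | false | _
isLine-parts x y () | true  | true  | true  | true  | true  | false

line-adjacent : ∀ {x y} → T (isLine x y) → Adjacent x y
line-adjacent {x} {y} t = let (px , py , ps , _ , _ , hc) = isLine-parts x y t in adjacent px py hc ps

point₁ point₂ point₃ : H2Line → H2Point
point₁ ((x , y) , t) = x , proj₁ (isLine-parts x y t)
point₂ ((x , y) , t) = y , proj₁ (proj₂ (isLine-parts x y t))
point₃ ((x , y) , t) = x ⊕ y , proj₁ (proj₂ (proj₂ (isLine-parts x y t)))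

point₁-on : ∀ l → point₁ l I₂ l
point₁-on _ = inj₁ refl

point₂-on : ∀ l → point₂ l I₂ l
point₂-on _ = inj₂ (inj₁ refl)

point₃-on : ∀ l → point₃ l I₂ l
point₃-on _ = inj₂ (inj₂ refl)

num-≢ : ∀ {p q : H2Point} → num (proj₁ p) < num (proj₁ q) → p ≢ q
num-≢ lt refl = ℕ.<-irrefl refl lt

point₁≢point₂ : ∀ l → point₁ l ≢ point₂ l
point₁≢point₂ ((x , y) , t) =
  num-≢ (ℕ.<ᵇ⇒< _ _ (proj₁ (proj₂ (proj₂ (proj₂ (isLine-parts x y t))))))

point₂≢point₃ : ∀ l → point₂ l ≢ point₃ l
point₂≢point₃ ((x , y) , t) =
  num-≢ (ℕ.<ᵇ⇒< _ _ (proj₁ (proj₂ (proj₂ (proj₂ (proj₂ (isLine-parts x y t)))))))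

point₁≢point₃ : ∀ l → point₁ l ≢ point₃ l
point₁≢point₃ ((x , y) , t) =
  num-≢ (ℕ.<-trans (ℕ.<ᵇ⇒< _ _ (proj₁ (proj₂ (proj₂ (proj₂ (isLine-parts x y t))))))
                 (ℕ.<ᵇ⇒< _ _ (proj₁ (proj₂ (proj₂ (proj₂ (proj₂ (isLine-parts x y t))))))))

collinear⇒adjacent : ∀ {p q} → Collinear _I₂_ p q → Adjacent (proj₁ p) (proj₁ q)
collinear⇒adjacent (p≢q , ((x , y) , t) , p∈ , q∈) = pair p∈ q∈ (p≢q ∘ point-≡)
  where
  xy : Adjacent x y
  xy = line-adjacent t

  ys : Adjacent y (x ⊕ y)
  ys = subst (Adjacent y) (⊕-comm y x) (adjacent-⊕ (adjacent-sym xy))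

  pair : ∀ {u v} → u ≡ x ⊎ u ≡ y ⊎ u ≡ x ⊕ y → v ≡ x ⊎ v ≡ y ⊎ v ≡ x ⊕ y → u ≢ v →
         Adjacent u v
  pair (inj₁ refl)        (inj₁ refl)        u≢v = ⊥-elim (u≢v refl)
  pair (inj₁ refl)        (inj₂ (inj₁ refl)) _   = xy
  pair (inj₁ refl)        (inj₂ (inj₂ refl)) _   = adjacent-⊕ xy
  pair (inj₂ (inj₁ refl)) (inj₁ refl)        _   = adjacent-sym xy
  pair (inj₂ (inj₁ refl)) (inj₂ (inj₁ refl)) u≢v = ⊥-elim (u≢v refl)
  pair (inj₂ (inj₁ refl)) (inj₂ (inj₂ refl)) _   = ys
  pair (inj₂ (inj₂ refl)) (inj₁ refl)        _   = adjacent-sym (adjacent-⊕ xy)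
  pair (inj₂ (inj₂ refl)) (inj₂ (inj₁ refl)) _   = adjacent-sym ys
  pair (inj₂ (inj₂ refl)) (inj₂ (inj₂ refl)) u≢v = ⊥-elim (u≢v refl)

WithinTwo : Vec7 → Vec7 → Set
WithinTwo u v = u ≡ v ⊎ Adjacent u v ⊎ ∃[ m ] (Adjacent u m × Adjacent m v)

within-two? : ∀ u v → Dec (WithinTwo u v)
within-two? u v =
  ≡-dec Bool._≟_ u v ⊎-dec adjacent? u v ⊎-dec ∃-vector? (λ m → adjacent? u m ×-dec adjacent? m v)

short-walk⇒within-two : ∀ {p q n} → Walk _I₂_ p q n → n ≤ 2 → WithinTwo (proj₁ p) (proj₁ q)
short-walk⇒within-two here                        _ = inj₁ refl
short-walk⇒within-two (step c here)               _ = inj₂ (inj₁ (collinear⇒adjacent c))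
short-walk⇒within-two (step c (step c′ here))     _ =
  inj₂ (inj₂ (_ , collinear⇒adjacent c , collinear⇒adjacent c′))
short-walk⇒within-two (step _ (step _ (step _ _))) (s≤s (s≤s ()))

sub-sub-cancelʳ : ∀ i j k → (i - k) - (j - k) ≡ i - j
sub-sub-cancelʳ = solve-∀

sub-sub-shift : ∀ i j k l → ((i - k) - (j - l)) ℤ.+ (k - l) ≡ i - j
sub-sub-shift = solve-∀

suc-sub : ∀ m k → + suc m - k ≡ (+ m - k) ℤ.+ + 1
suc-sub m k = lemma (+ m) k
  where
  lemma : ∀ i k → (+ 1 ℤ.+ i) - k ≡ (i - k) ℤ.+ + 1
  lemma = solve-∀

sub-≡⇒+-≡ : ∀ a b c e → + a - + b ≡ + c - + e → a ℕ.+ e ≡ c ℕ.+ b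
sub-≡⇒+-≡ a b c e eq = ℤ.+-injective (begin
  + a ℤ.+ + e                   ≡⟨ split (+ a) (+ b) (+ e) ⟩
  (+ a - + b) ℤ.+ (+ b ℤ.+ + e) ≡⟨ cong (ℤ._+ (+ b ℤ.+ + e)) eq ⟩
  (+ c - + e) ℤ.+ (+ b ℤ.+ + e) ≡⟨ regroup (+ c) (+ b) (+ e) ⟩
  + c ℤ.+ + b                   ∎)
  where
  open ≡-Reasoning
  split : ∀ i j k → i ℤ.+ k ≡ (i - j) ℤ.+ (j ℤ.+ k)
  split = solve-∀
  regroup : ∀ i j k → (i - k) ℤ.+ (j ℤ.+ k) ≡ i ℤ.+ j
  regroup = solve-∀

≤⇒0≤- : ∀ {m n} → m ≤ n → + 0 ℤ.≤ + n - + m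
≤⇒0≤- {m} {n} m≤n rewrite ℤ.m-n≡m⊖n n m | ℤ.⊖-≥ m≤n = +≤+ z≤n

below-three : ∀ {a b} → b ≡ suc a → b ≤ 3 → a ≤ 2
below-three refl = s≤s⁻¹

+-≡-cancel : ∀ {a b c e} → a + e ≡ c + b → b ≡ e → a ≡ c
+-≡-cancel eq refl = ℕ.+-cancelʳ-≡ _ _ _ eq

+-≡-cancel-< : ∀ {a b c e} → a + e ≡ c + b → b < e → a < c
+-≡-cancel-< {a} {b} {c} {e} eq b<e =
  ℕ.+-cancelʳ-< e a c (subst (_< c + e) (sym eq) (ℕ.+-monoʳ-< c b<e))

≤1-cases : ∀ {n} → n ≤ 1 → n ≡ 0 ⊎ n ≡ 1
≤1-cases z≤n       = inj₁ refl
≤1-cases (s≤s z≤n) = inj₂ refl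

module _ {a ℓ₁ ℓ₂} {O : TotalPreorder a ℓ₁ ℓ₂} (minOp : MinOperator O) where
  open TotalPreorder O using (Carrier; _≈_; _≲_; module Eq) renaming (trans to ≲-trans)
  open MinOperator minOp using (_⊓_)
  open MinOp minOp using (x⊓y≤x; x⊓y≤y; ⊓-sel)

  foldr-⊓-≲ : ∀ {B : Set} (f : B → Carrier) b {y} xs → y ∈ xs →
              foldr _⊓_ (f b) (map f xs) ≲ f y
  foldr-⊓-≲ f b (x ∷ xs) (here refl) = x⊓y≤x (f x) _
  foldr-⊓-≲ f b (x ∷ xs) (there y∈) = ≲-trans (x⊓y≤y (f x) _) (foldr-⊓-≲ f b xs y∈)

  foldr-⊓-attained : ∀ {B : Set} (f : B → Carrier) b xs →
                     ∃[ y ] foldr _⊓_ (f b) (map f xs) ≈ f y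
  foldr-⊓-attained f b [] = b , Eq.refl
  foldr-⊓-attained f b (x ∷ xs) with ⊓-sel (f x) (foldr _⊓_ (f b) (map f xs))
  ... | inj₁ e = x , e
  ... | inj₂ e = let y , e′ = foldr-⊓-attained f b xs in y , Eq.trans e e′

minOverH2ℕ-≤ : ∀ f y → minOverH2ℕ f ≤ f y
minOverH2ℕ-≤ f y = foldr-⊓-≲ ℕ.⊓-operator f basePoint allH2Points (allH2Points-complete y)

minOverH2ℕ-attained : ∀ f → ∃[ y ] minOverH2ℕ f ≡ f y
minOverH2ℕ-attained f = foldr-⊓-attained ℕ.⊓-operator f basePoint allH2Points

minOverH2ℤ-≤ : ∀ f y → minOverH2ℤ f ℤ.≤ f y
minOverH2ℤ-≤ f y = foldr-⊓-≲ ℤ.⊓-operator f basePoint allH2Points (allH2Points-complete y)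

minOverH2ℤ-attained : ∀ f → ∃[ y ] minOverH2ℤ f ≡ f y
minOverH2ℤ-attained f = foldr-⊓-attained ℤ.⊓-operator f basePoint allH2Points

minOverH2ℤ-shift : ∀ (f : Valuation) g k → (∀ y → f y ≡ + g y - k) →
                   minOverH2ℤ f ≡ + minOverH2ℕ g - k
minOverH2ℤ-shift f g k f≡ = ℤ.≤-antisym upper lower
  where
  open ℤ.≤-Reasoning
  upper : minOverH2ℤ f ℤ.≤ + minOverH2ℕ g - k
  upper = let y , e = minOverH2ℕ-attained g in begin
    minOverH2ℤ f       ≤⟨ minOverH2ℤ-≤ f y ⟩
    f y                ≡⟨ f≡ y ⟩
    + g y - k          ≡⟨ cong (λ n → + n - k) e ⟨
    + minOverH2ℕ g - k ∎
  lower : + minOverH2ℕ g - k ℤ.≤ minOverH2ℤ f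
  lower = let y , e = minOverH2ℤ-attained f in begin
    + minOverH2ℕ g - k ≤⟨ ℤ.+-monoˡ-≤ (ℤ.- k) (+≤+ (minOverH2ℕ-≤ g y)) ⟩
    + g y - k          ≡⟨ f≡ y ⟨
    f y                ≡⟨ e ⟨
    minOverH2ℤ f       ∎

-- As a record, Opposite p q determines p and q, and for concrete points an implicit argument of this
-- type is filled in by η-expansion, its field computing to ⊤.
record Opposite (p q : H2Point) : Set where
  constructor opposite
  field
    not-within-two : False (within-two? (proj₁ p) (proj₁ q))

-- eᵢⱼ… is the point whose coordinates i, j, … are 1 and all others 0.
⟨_⟩ : List ℕ → Vec7
⟨ is ⟩ = tabulate (λ j → any (toℕ j ℕ.≡ᵇ_) is)

pt : (v : Vec7) → {T (isPoint v)} → H2Point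
pt v {p} = v , p

ln : (p q : H2Point) → {T (isLine (proj₁ p) (proj₁ q))} → H2Line
ln (u , _) (v , _) {t} = (u , v) , t

e₀ e₁ e₂ e₄ e₅ e₆ e₀₆ e₁₄ e₁₆ e₂₄ e₀₃₄ e₂₃₆ e₀₁₃₄₆ e₁₂₃₄₆ : H2Point
e₀     = pt ⟨ 0 ∷ [] ⟩
e₁     = pt ⟨ 1 ∷ [] ⟩
e₂     = pt ⟨ 2 ∷ [] ⟩
e₄     = pt ⟨ 4 ∷ [] ⟩
e₅     = pt ⟨ 5 ∷ [] ⟩
e₆     = pt ⟨ 6 ∷ [] ⟩
e₀₆    = pt ⟨ 0 ∷ 6 ∷ [] ⟩
e₁₄    = pt ⟨ 1 ∷ 4 ∷ [] ⟩
e₁₆    = pt ⟨ 1 ∷ 6 ∷ [] ⟩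
e₂₄    = pt ⟨ 2 ∷ 4 ∷ [] ⟩
e₀₃₄   = pt ⟨ 0 ∷ 3 ∷ 4 ∷ [] ⟩
e₂₃₆   = pt ⟨ 2 ∷ 3 ∷ 6 ∷ [] ⟩
e₀₁₃₄₆ = pt ⟨ 0 ∷ 1 ∷ 3 ∷ 4 ∷ 6 ∷ [] ⟩
e₁₂₃₄₆ = pt ⟨ 1 ∷ 2 ∷ 3 ∷ 4 ∷ 6 ∷ [] ⟩

module Embedding (N : NearHexagon) (H : IsometricH2 N) where
  open NearHexagon N
  open IsometricH2 H
  open Distance N
  open Equivalence using (to; from)

  dist : Point → H2Point → ℕ
  dist x p = d x (h p)

  δ : Point → ℕ
  δ x = minOverH2ℕ (dist x)

  f : Point → Valuation
  f = fval N H

  H-line-nearest : ∀ x l → ∃[ p ] (p I₂ l × ∀ q → q I₂ l → q ≢ p → dist x q ≡ suc (dist x p))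
  H-line-nearest x l with nearest x (hl l)
  ... | p₀ , p₀-on , near with full p₀ l p₀-on
  ... | p , refl = p , from (incidence p l) p₀-on , λ q q-on q≢p →
    nearest-distance p₀-on near (to (incidence q l) q-on) (q≢p ∘ h-injective q p)

  H-line-profile : ∀ x l →
                   LineProfile (dist x (point₁ l)) (dist x (point₂ l)) (dist x (point₃ l))
  H-line-profile x l =
    profile-cong (d-sym _ x) (d-sym _ x) (d-sym _ x)
      (line-profile (image-on point₁ point₁-on) (image-on point₂ point₂-on)
                    (image-on point₃ point₃-on)
                    (point₁≢point₂ l ∘ h-injective _ _) (point₁≢point₃ l ∘ h-injective _ _)
                    (point₂≢point₃ l ∘ h-injective _ _) x)
    where
    image-on : (p : H2Line → H2Point) → (∀ l → p l I₂ l) → h (p l) I hl l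
    image-on p p-on = to (incidence (p l) l) (p-on l)

  far-apart : ∀ x {p q} → Opposite p q → 3 ≤ dist x p + dist x q
  far-apart x {p} {q} (opposite opp) =
    ℕ.≮⇒≥ λ sum<3 → toWitnessFalse opp (short-walk⇒within-two walk-in-H (n≤2 sum<3))
    where
    n = d (h p) (h q)
    n≤2 : dist x p + dist x q < 3 → n ≤ 2
    n≤2 sum<3 = ℕ.≤-trans (subst (λ m → n ≤ m + dist x q) (d-sym (h p) x) (d-triangle (h p) x (h q)))
                          (s≤s⁻¹ sum<3)
    walk-in-H : Walk _I₂_ p q n
    walk-in-H = proj₁ (from (isometric p q n) (proj₂ (proj₂ (distance (h p) (h q)))))

  no-point-within-two : ∀ x → ¬ (∀ p → dist x p ≤ 2)
  no-point-within-two x bounded =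
    close-point-refuted
      (profile-closer (H-line-profile x (ln e₀ e₆)) (bounded e₀) (bounded e₆) (bounded e₀₆))
    where
    not-at-zero : ∀ {p q} → Opposite p q → dist x p ≢ 0
    not-at-zero {p} {q} opp p≡0 =
      ℕ.1+n≰n (ℕ.≤-trans (subst (λ m → 3 ≤ m + dist x q) p≡0 (far-apart x opp)) (bounded q))

    at-two : ∀ {p q} → Opposite p q → dist x p ≡ 1 → dist x q ≡ 2
    at-two {p} {q} opp p≡1 =
      ℕ.≤-antisym (bounded q) (s≤s⁻¹ (subst (λ m → 3 ≤ m + dist x q) p≡1 (far-apart x opp)))

    -- If p were at distance 1, the qᵢ would be at distance 2, hence a and b at distance 1, and c = x.
    refute : ∀ p q₁ q₁′ q₂ q₂′ a b c s →
             {Opposite p q₁} → {Opposite p q₁′} → {Opposite p q₂} → {Opposite p q₂′} →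
             {Opposite c s} →
             LineProfile (dist x a) (dist x q₁) (dist x q₁′) →
             LineProfile (dist x b) (dist x q₂) (dist x q₂′) →
             LineProfile (dist x c) (dist x a) (dist x b) → dist x p ≤ 1 → ⊥
    refute p q₁ q₁′ q₂ q₂′ a b c s {o₁} {o₁′} {o₂} {o₂′} {o} A B C p≤1 =
      [ not-at-zero o₁ , (λ p≡1 → not-at-zero o (profile-nearest C (a≡1 p≡1) (b≡1 p≡1))) ]
        (≤1-cases p≤1)
      where
      a≡1 : dist x p ≡ 1 → dist x a ≡ 1
      a≡1 p≡1 = profile-nearest A (at-two o₁ p≡1) (at-two o₁′ p≡1)
      b≡1 : dist x p ≡ 1 → dist x b ≡ 1
      b≡1 p≡1 = profile-nearest B (at-two o₂ p≡1) (at-two o₂′ p≡1)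

    close-point-refuted : dist x e₀ ≤ 1 ⊎ dist x e₆ ≤ 1 ⊎ dist x e₀₆ ≤ 1 → ⊥
    close-point-refuted (inj₁ e₀-close) =
      refute e₀ e₄ e₁₄ e₀₃₄ e₀₁₃₄₆ e₁ e₁₆ e₆ e₂
        (H-line-profile x (ln e₁ e₄)) (profile-swap₁₂ (H-line-profile x (ln e₀₃₄ e₁₆)))
        (profile-swap₁₂ (H-line-profile x (ln e₁ e₆))) e₀-close
    close-point-refuted (inj₂ (inj₁ e₆-close)) =
      refute e₆ e₂ e₂₄ e₂₃₆ e₁₂₃₄₆ e₄ e₁₄ e₁ e₅
        (profile-swap₁₂ (H-line-profile x (ln e₂ e₄))) (H-line-profile x (ln e₁₄ e₂₃₆))
        (H-line-profile x (ln e₁ e₄)) e₆-close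
    close-point-refuted (inj₂ (inj₂ e₀₆-close)) =
      refute e₀₆ e₄ e₁₄ e₀₃₄ e₀₁₃₄₆ e₁ e₁₆ e₆ e₂
        (H-line-profile x (ln e₁ e₄)) (profile-swap₁₂ (H-line-profile x (ln e₀₃₄ e₁₆)))
        (profile-swap₁₂ (H-line-profile x (ln e₁ e₆))) e₀₆-close

  f-isValuation : ∀ x → IsValuation (f x)
  f-isValuation x = nonnegative , vanishes , line-minimum
    where
    nonnegative : ∀ y → + 0 ℤ.≤ f x y
    nonnegative y = ≤⇒0≤- (minOverH2ℕ-≤ (dist x) y)

    vanishes : ∃[ y ] f x y ≡ + 0
    vanishes = let y , δ≡ = minOverH2ℕ-attained (dist x) in
      y , trans (cong (λ n → + dist x y - + n) δ≡) (ℤ.+-inverseʳ (+ dist x y))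

    line-minimum : ∀ l → ∃[ p ] (p I₂ l × ∀ q → q I₂ l → q ≢ p → f x q ≡ f x p ℤ.+ + 1)
    line-minimum l = let p , p-on , further = H-line-nearest x l in
      p , p-on , λ q q-on q≢p →
        trans (cong (λ n → + n - + δ x) (further q q-on q≢p)) (suc-sub (dist x p) (+ δ x))

  module OnLine {l x₁ x₂ x₃} (on₁ : x₁ I l) (on₂ : x₂ I l) (on₃ : x₃ I l)
                (x₁≢x₂ : x₁ ≢ x₂) (x₁≢x₃ : x₁ ≢ x₃) (x₂≢x₃ : x₂ ≢ x₃) where

    profile : ∀ y → LineProfile (dist x₁ y) (dist x₂ y) (dist x₃ y)
    profile y = line-profile on₁ on₂ on₃ x₁≢x₂ x₁≢x₃ x₂≢x₃ (h y)

    balanced : f x₁ ≗ f x₂ → ∀ y → dist x₁ y + δ x₂ ≡ dist x₂ y + δ x₁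
    balanced f₁≗f₂ y = sub-≡⇒+-≡ (dist x₁ y) (δ x₁) (dist x₂ y) (δ x₂) (f₁≗f₂ y)

    f₁≉f₂ : ¬ (f x₁ ≗ f x₂)
    f₁≉f₂ f₁≗f₂ with ℕ.<-cmp (δ x₁) (δ x₂)
    ... | tri< δ₁<δ₂ _ _ = no-point-within-two x₁ λ y →
          below-three (profile-< (profile y) (+-≡-cancel-< (balanced f₁≗f₂ y) δ₁<δ₂)) (d≤3 x₂ (h y))
    ... | tri≈ _ δ₁≡δ₂ _ = no-point-within-two x₃ λ y →
          below-three (profile-≡ (profile y) (+-≡-cancel (balanced f₁≗f₂ y) δ₁≡δ₂)) (d≤3 x₁ (h y))
    ... | tri> _ _ δ₂<δ₁ = no-point-within-two x₂ λ y →
          below-three (profile-< (profile-swap₁₂ (profile y))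
                                 (+-≡-cancel-< (sym (balanced f₁≗f₂ y)) δ₂<δ₁))
                      (d≤3 x₁ (h y))

    ε : ℤ
    ε = + δ x₁ - + δ x₂

    neighboring : Neighboring (f x₁) (f x₂) ε
    neighboring y = subst (λ i → ∣ i ∣ ≤ 1)
      (sym (sub-sub-shift (+ dist x₁ y) (+ dist x₂ y) (+ δ x₁) (+ δ x₂)))
      (profile-neighboring (profile y))

    star′-values : ∀ y → star' (f x₁) (f x₂) ε y ≡ + dist x₃ y - + δ x₁
    star′-values y = begin
      star' (f x₁) (f x₂) ε y
        ≡⟨ star′-merge (f x₁) (f x₂) ε y ⟩
      merge (f x₁ y) (f x₂ y - ε)
        ≡⟨ cong (merge (f x₁ y)) (sub-sub-cancelʳ (+ dist x₂ y) (+ δ x₁) (+ δ x₂)) ⟩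
      merge (+ dist x₁ y - + δ x₁) (+ dist x₂ y - + δ x₁)
        ≡⟨ profile-merge (profile y) (+ δ x₁) ⟩
      + dist x₃ y - + δ x₁ ∎
      where open ≡-Reasoning

    f₃≗f₁∗f₂ : f x₃ ≗ star (f x₁) (f x₂) ε
    f₃≗f₁∗f₂ y = sym (begin
      star' (f x₁) (f x₂) ε y - minOverH2ℤ (star' (f x₁) (f x₂) ε)
        ≡⟨ cong₂ _-_ (star′-values y)
                     (minOverH2ℤ-shift (star' (f x₁) (f x₂) ε) (dist x₃) (+ δ x₁) star′-values) ⟩
      (+ dist x₃ y - + δ x₁) - (+ δ x₃ - + δ x₁)
        ≡⟨ sub-sub-cancelʳ (+ dist x₃ y) (+ δ x₃) (+ δ x₁) ⟩
      + dist x₃ y - + δ x₃ ∎)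
      where open ≡-Reasoning

    ordered : OrderedVLine (f x₁) (f x₂) (f x₃)
    ordered = ε , neighboring , f₃≗f₁∗f₂

lemma4p3 : (N : NearHexagon) (H : IsometricH2 N) →
    let open NearHexagon N in
    (l : Line) (x₁ x₂ x₃ : Point) →
    x₁ I l → x₂ I l → x₃ I l → x₁ ≢ x₂ → x₁ ≢ x₃ → x₂ ≢ x₃ →
    MutuallyDistinct (fval N H x₁) (fval N H x₂) (fval N H x₃) ×
    IsVLine (fval N H x₁) (fval N H x₂) (fval N H x₃)
lemma4p3 N H l x₁ x₂ x₃ on₁ on₂ on₃ x₁≢x₂ x₁≢x₃ x₂≢x₃ =
  distinct , f-isValuation x₁ , f-isValuation x₂ , f-isValuation x₃ , distinct ,
  inj₁ (OnLine.ordered on₁ on₂ on₃ x₁≢x₂ x₁≢x₃ x₂≢x₃)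
  where
  open Embedding N H
  distinct : MutuallyDistinct (f x₁) (f x₂) (f x₃)
  distinct = OnLine.f₁≉f₂ on₁ on₂ on₃ x₁≢x₂ x₁≢x₃ x₂≢x₃ ,
             OnLine.f₁≉f₂ on₁ on₃ on₂ x₁≢x₃ x₁≢x₂ (≢-sym x₂≢x₃) ,
             OnLine.f₁≉f₂ on₂ on₃ on₁ x₂≢x₃ (≢-sym x₁≢x₂) (≢-sym x₁≢x₃)
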